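{- Let $k\ge 0$ and let $((W, R, V), w_d)$ be a pointed model. Then: (1) $w_d \in \mathrm{Max}(W)$; (2) for all $w,v\in W$, if $w \succ v$ then $v \notin \mathrm{Max}(W)$; (3) for all $w\in W$, if $b(w) < 0$ then $w \notin \mathrm{Max}(W)$; (4) for all $w,v\in \mathrm{Max}(W)$, if $w \sim_{b(w)} v$ then $b(w) = b(v)$.
   Context: Fix a countable set $\mathcal{P}$ of atomic propositions and a finite set $\mathcal{I}$ of modality indices. A model is $M=(W,R,V)$ with $W$ finite nonempty, $R_i\subseteq W\times W$ for each $i\in\mathcal{I}$, and $V:\mathcal{P}\to 2^W$; a pointed model is $(M,w_d)$ with $w_d\in W$. For $h\ge0$, $h$-bisimilarity $\sim_h$ is the standard bounded bisimulation: a sequence $Z_h\subseteq\cdots\subseteq Z_0$ of nonempty relations containing the designated pair in $Z_h$, with atom agreement on $Z_0$ and forth/back conditions from $Z_{j+1}$ to $Z_j$ for $j<h$; for worlds $w,v$ of the same model, $w\sim_h v$ means $(M,w)\sim_h(M,v)$. Given $(M,w_d)$ and $k$, the depth $d(w)$ is the length of a shortest path from $w_d$ to $w$ along edges of any $R_i$ ($\infty$ if none) and the bound is $b(w)=k-d(w)$. For worlds $x,y$ with nonnegative bound, $x$ represents $y$, written $x\succeq y$, iff $b(x)\ge b(y)$ and $x\sim_{b(y)}y$; $x$ strictly represents $y$, written $x\succ y$, iff moreover $b(x)>b(y)$. The set of maximal representatives is $\mathrm{Max}(W)=\{x\in W\mid b(x)\ge0\text{ and there is no }y\in W\text{ with }y\succ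 x\}$. -}

module Defs where

open import Data.Nat using (ℕ; zero; suc; _≤_; _<_)
open import Data.Integer using (ℤ; +_; _-_) renaming (_<_ to _<ℤ_)
open import Data.Fin using (Fin)
open import Data.Bool using (Bool; true; false; _∧_; if_then_else_)
open import Data.Maybe using (Maybe; just; nothing)
open import Data.Product using (Σ; _×_; ∃)
open import Data.Unit using (⊤)
open import Data.Empty using (⊥)
open import Data.List using (List; allFin)
open import Data.Bool.ListAction using (any)

open import Relation.Binary.PropositionalEquality using (_≡_)
open import Relation.Nullary using (¬_)

-- Nonemptiness of W is implied by the designated world of a pointed model.
record Model (m : ℕ) : Set where
  field
    size : ℕ
    R    : Fin m → Fin size → Fin size → Bool
    V    : ℕ → Fin size → Bool

open Model public

World : ∀ {m} → Model m → Set
World M = Fin (size M)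

private
  anyFin : ∀ {n} → (Fin n → Bool) → Bool
  anyFin {n} f = any f (allFin n)

walk : ∀ {m} (M : Model m) → World M → ℕ → World M → Bool
walk {m} M wd zero    w = isEq
  where
    open import Data.Fin using (_≟_)
    open import Relation.Nullary.Decidable using (⌊_⌋)
    isEq = ⌊ wd ≟ w ⌋
walk {m} M wd (suc j) w =
  anyFin (λ u → walk M wd j u ∧ anyFin {m} (λ i → R M i u w))

firstTrue : (ℕ → Bool) → ℕ → ℕ → Maybe ℕ
firstTrue p from zero       = nothing
firstTrue p from (suc fuel) =
  if p from then just from else firstTrue p (suc from) fuel

-- Depth d(w): length of a shortest path from wd to w (nothing = ∞).
-- A shortest path, if it exists, has length < size M, so searching
-- lengths 0 .. size M - 1 is exhaustive.
depth : ∀ {m} (M : Model m) → World M → World M → Maybe ℕ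
depth M wd w = firstTrue (λ j → walk M wd j w) 0 (size M)

-- Bound b(w) = k - d(w), with nothing standing for -∞ (when d(w) = ∞).
bound : ∀ {m} (M : Model m) → World M → ℕ → World M → Maybe ℤ
bound M wd k w with depth M wd w
... | just d  = just (+ k - + d)
... | nothing = nothing

NegBound : Maybe ℤ → Set
NegBound (just z) = z <ℤ + 0
NegBound nothing  = ⊤

-- h-bisimilarity between (M , w) and (N , v): relations Z h ⊆ … ⊆ Z 0,
-- designated pair in Z h, atom agreement on Z 0, forth/back from Z (j+1) to Z j
-- for j < h.  (Nonemptiness of every Z j follows from `designated` and `mono`.)
record Bisim {m} (M N : Model m) (h : ℕ) (w : World M) (v : World N) : Set₁ where
  field
    Z          : ℕ → World M → World N → Set
    mono       : ∀ j → j < h → ∀ x y → Z (suc j) x y → Z j x y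
    designated : Z h w v
    atoms      : ∀ x y → Z 0 x y → ∀ p → V M p x ≡ V N p y
    forth      : ∀ j → j < h → ∀ i x y x′ → Z (suc j) x y → R M i x x′ ≡ true →
                 Σ (World N) λ y′ → (R N i y y′ ≡ true) × Z j x′ y′
    back       : ∀ j → j < h → ∀ i x y y′ → Z (suc j) x y → R N i y y′ ≡ true →
                 Σ (World M) λ x′ → (R M i x x′ ≡ true) × Z j x′ y′

Represents : ∀ {m} (M : Model m) → World M → ℕ → World M → World M → Set₁
Represents M wd k x y =
  Σ ℕ λ bx → Σ ℕ λ by →
    (bound M wd k x ≡ just (+ bx)) × (bound M wd k y ≡ just (+ by)) ×
    (by ≤ bx) × Bisim M M by x y

StrictRep : ∀ {m} (M : Model m) → World M → ℕ → World M → World M → Set₁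
StrictRep M wd k x y =
  Σ ℕ λ bx → Σ ℕ λ by →
    (bound M wd k x ≡ just (+ bx)) × (bound M wd k y ≡ just (+ by)) ×
    (by < bx) × Bisim M M by x y

InMax : ∀ {m} (M : Model m) → World M → ℕ → World M → Set₁
InMax M wd k x =
  (Σ ℕ λ bx → bound M wd k x ≡ just (+ bx)) ×
  (∀ y → ¬ StrictRep M wd k y x)

{-# OPTIONS --safe #-}

-- The designated world has bound k, the largest bound any world can have,
-- so nothing strictly represents it.  For (4), if b(w) and b(v) differed, the world
-- with the larger bound would strictly represent the other one, after
-- weakening w ∼_{b(w)} v to the smaller bound and, if needed, flipping it.
module Submission where

open import Defs
open import Data.Nat using (ℕ; suc; _≤_; _≤′_; ≤′-refl; ≤′-step; NonZero)
open import Data.Nat.Properties using (<-cmp; <-irrefl; <-≤-trans; <⇒≤; m<n⇒m<1+n; n<1+n; ≤⇒≤′)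
open import Data.Integer using (+_; +<+) renaming (_≤_ to _≤ℤ_)
open import Data.Integer.Properties using (+-identityʳ; +-injective; drop‿+≤+; i-j≤i)
open import Data.Maybe using (just)
open import Data.Maybe.Properties using (just-injective)
open import Data.Product using (_×_; _,_)
open import Data.Bool using (Bool; true)
open import Data.Fin using (_≟_)
open import Data.Fin.Properties using (nonZeroIndex)
open import Data.Empty using (⊥-elim)
open import Relation.Binary using (tri<; tri≈; tri>)
open import Relation.Binary.PropositionalEquality using (_≡_; refl; sym; trans; cong; subst)
open import Relation.Nullary using (¬_; yes; no)

module _ {m} {M N : Model m} where

  Bisim-sym : ∀ {h w v} → Bisim M N h w v → Bisim N M h v w
  Bisim-sym b = record
    { Z          = λ j x y → Z j y x
    ; mono       = λ j j<h x y → mono j j<h y x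
    ; designated = designated
    ; atoms      = λ x y z p → sym (atoms y x z p)
    ; forth      = λ j j<h i x y → back j j<h i y x
    ; back       = λ j j<h i x y → forth j j<h i y x
    }
    where open Bisim b

  Bisim-pred : ∀ {h w v} → Bisim M N (suc h) w v → Bisim M N h w v
  Bisim-pred {h} b = record
    { Z          = Z
    ; mono       = λ j j<h → mono j (m<n⇒m<1+n j<h)
    ; designated = mono h (n<1+n h) _ _ designated
    ; atoms      = atoms
    ; forth      = λ j j<h → forth j (m<n⇒m<1+n j<h)
    ; back       = λ j j<h → back j (m<n⇒m<1+n j<h)
    }
    where open Bisim b

  Bisim-weaken′ : ∀ {h h′ w v} → h′ ≤′ h → Bisim M N h w v → Bisim M N h′ w v
  Bisim-weaken′ ≤′-refl       b = b
  Bisim-weaken′ (≤′-step h′≤h) b = Bisim-weaken′ h′≤h (Bisim-pred b)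

  Bisim-weaken : ∀ {h h′ w v} → h′ ≤ h → Bisim M N h w v → Bisim M N h′ w v
  Bisim-weaken h′≤h = Bisim-weaken′ (≤⇒≤′ h′≤h)

firstTrue-hit : ∀ {p : ℕ → Bool} {from} fuel .{{_ : NonZero fuel}} →
                p from ≡ true → firstTrue p from fuel ≡ just from
firstTrue-hit (suc _) p-from rewrite p-from = refl

module _ {m} (M : Model m) (wd : World M) where

  walk-zero-refl : walk M wd 0 wd ≡ true
  walk-zero-refl with wd ≟ wd
  ... | yes _    = refl
  ... | no wd≢wd = ⊥-elim (wd≢wd refl)

  depth-root : depth M wd wd ≡ just 0
  depth-root = firstTrue-hit (size M) {{nonZeroIndex wd}} walk-zero-refl

  bound-root : ∀ k → bound M wd k wd ≡ just (+ k)
  bound-root k rewrite depth-root = cong just (+-identityʳ (+ k))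

  bound≤k : ∀ k w {b} → bound M wd k w ≡ just (+ b) → b ≤ k
  bound≤k k w b-w with depth M wd w
  ... | just d = drop‿+≤+ (subst (_≤ℤ + k) (just-injective b-w) (i-j≤i (+ k) (+ d)))

  module _ (k : ℕ) where

    root-InMax : InMax M wd k wd
    root-InMax = (k , bound-root k) , root-unrepresented
      where
      root-unrepresented : ∀ y → ¬ StrictRep M wd k y wd
      root-unrepresented y (by , bwd , b-y , b-wd , bwd<by , _)
        with +-injective (just-injective (trans (sym b-wd) (bound-root k)))
      ... | refl = <-irrefl refl (<-≤-trans bwd<by (bound≤k k y b-y))

    StrictRep⇒¬InMax : ∀ w v → StrictRep M wd k w v → ¬ InMax M wd k v
    StrictRep⇒¬InMax w v w≻v (_ , unrepresented) = unrepresented w w≻v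

    NegBound⇒¬InMax : ∀ w → NegBound (bound M wd k w) → ¬ InMax M wd k w
    NegBound⇒¬InMax w neg ((b , b-w) , _) rewrite b-w with neg
    ... | +<+ ()

    InMax-Bisim⇒bound≡ : ∀ w v → InMax M wd k w → InMax M wd k v →
                         ∀ bw → bound M wd k w ≡ just (+ bw) → Bisim M M bw w v →
                         bound M wd k w ≡ bound M wd k v
    InMax-Bisim⇒bound≡ w v (_ , w-max) ((bv , b-v) , v-max) bw b-w w∼v
      with <-cmp bw bv
    ... | tri< bw<bv _ _ = ⊥-elim (w-max v (bv , bw , b-v , b-w , bw<bv , Bisim-sym w∼v))
    ... | tri≈ _ refl _  = trans b-w (sym b-v)
    ... | tri> _ _ bv<bw =
      ⊥-elim (v-max w (bw , bv , b-w , b-v , bv<bw , Bisim-weaken (<⇒≤ bv<bw) w∼v))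

proposition3p7 : ∀ {m} (k : ℕ) (M : Model m) (wd : World M) →
    InMax M wd k wd ×
    (∀ w v → StrictRep M wd k w v → ¬ InMax M wd k v) ×
    (∀ w → NegBound (bound M wd k w) → ¬ InMax M wd k w) ×
    (∀ w v → InMax M wd k w → InMax M wd k v →
      ∀ bw → bound M wd k w ≡ just (+ bw) → Bisim M M bw w v →
      bound M wd k w ≡ bound M wd k v)
proposition3p7 k M wd =
  root-InMax M wd k , StrictRep⇒¬InMax M wd k , NegBound⇒¬InMax M wd k , InMax-Bisim⇒bound≡ M wd k
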